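{- For every integer $n\ge0$, there is a bijection between the set of leaf-colored doubly rooted plane trees with $n$ edges and the set of free Schröder paths of length $2n$.
   Context: A plane tree is a rooted tree with linearly ordered children; a leaf is a non-root vertex with no children. A doubly rooted plane tree is a plane tree with a distinguished vertex (possibly the root). A leaf-colored doubly rooted plane tree is a doubly rooted plane tree in which every leaf other than the distinguished vertex is colored red or blue (the distinguished vertex receives no color even if it is a leaf). A free Schröder path of length $2n$ is any lattice path from $(0,0)$ to $(2n,0)$ with steps $U=(1,1)$, $H=(2,0)$, $D=(1,-1)$, with no further restriction. -}

module Defs where

open import Data.Bool using (Bool; true; false; _∧_; if_then_else_)
open import Data.Maybe using (Maybe; just; nothing; is-just; is-nothing)
open import Data.List using (List; []; _∷_)
open import Data.Nat using (ℕ; zero; suc; _+_; _*_)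
open import Data.Integer using (ℤ) renaming (_+_ to _+ℤ_; +_ to +ℤ_)
open import Data.Product using (Σ; _×_; _,_)
open import Data.Unit using (⊤)
open import Data.Bool using (T)
open import Relation.Binary.PropositionalEquality using (_≡_)

data PlaneTree (A : Set) : Set where
  node : A → List (PlaneTree A) → PlaneTree A

mutual
  edges : {A : Set} → PlaneTree A → ℕ
  edges (node _ ts) = edgesF ts

  edgesF : {A : Set} → List (PlaneTree A) → ℕ
  edgesF [] = 0
  edgesF (t ∷ ts) = suc (edges t) + edgesF ts

-- Leaf-colored doubly rooted plane trees.
-- Each vertex is labelled by (is it the distinguished vertex?, its color).

data Color : Set where
  red blue : Color

Label : Set
Label = Bool × Maybe Color

mutual
  marks : PlaneTree Label → ℕ
  marks (node (m , _) ts) = (if m then 1 else 0) + marksF ts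

  marksF : List (PlaneTree Label) → ℕ
  marksF [] = 0
  marksF (t ∷ ts) = marks t + marksF ts

-- Coloring condition: a vertex carries a color exactly when it is a leaf
-- (a non-root vertex with no children) other than the distinguished vertex.
mutual
  -- the root (never a leaf, so never colored)
  colorOkRoot : PlaneTree Label → Bool
  colorOkRoot (node (_ , c) ts) = is-nothing c ∧ colorOkF ts

  colorOkSub : PlaneTree Label → Bool
  colorOkSub (node (m , c) []) = if m then is-nothing c else is-just c
  colorOkSub (node (_ , c) (t ∷ ts)) = is-nothing c ∧ colorOkF (t ∷ ts)

  colorOkF : List (PlaneTree Label) → Bool
  colorOkF [] = true
  colorOkF (t ∷ ts) = colorOkSub t ∧ colorOkF ts

LCDRTree : ℕ → Set
LCDRTree n = Σ (PlaneTree Label) λ t →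
  (edges t ≡ n) × (marks t ≡ 1) × T (colorOkRoot t)

data Step : Set where
  U H D : Step   -- U = (1,1), H = (2,0), D = (1,-1)

xlen : List Step → ℕ
xlen [] = 0
xlen (U ∷ s) = 1 + xlen s
xlen (H ∷ s) = 2 + xlen s
xlen (D ∷ s) = 1 + xlen s

height : List Step → ℤ
height [] = +ℤ 0
height (U ∷ s) = +ℤ 1 +ℤ height s
height (H ∷ s) = height s
height (D ∷ s) = Data.Integer.-[1+ 0 ] +ℤ height s

FreeSchroeder : ℕ → Set
FreeSchroeder n = Σ (List Step) λ s → (xlen s ≡ 2 * n) × (height s ≡ +ℤ 0)

-- Cut the tree along the path from the root to the distinguished vertex.  Each
-- vertex of that path has a forest to the left of the path and one to the right,
-- and the distinguished vertex has the forest of its children.  In preorder, a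
-- red leaf becomes H and every other vertex U … D around its subtree (a blue leaf
-- becomes UD), so a forest becomes a path never going below its starting height,
-- and reflected, one never going above it.  A vertex (a, b) of the path
-- contributes a D b′ U, with b′ the reflected encoding of b, and the
-- distinguished vertex contributes its forest: this is the unique factorisation
-- of a free Schröder path at the up-steps by which it returns to the axis.
-- The inverse is a stack-machine parser.
module Submission where

open import Defs
open import Axiom.UniquenessOfIdentityProofs using (module Decidable⇒UIP)
open import Data.Bool using (true; false; _∧_; T)
open import Data.Bool.Properties using (T-∧; T-irrelevant)
open import Data.Integer using (ℤ; +_; -[1+_]) renaming (_+_ to _+ℤ_)
import Data.Integer.Properties as ℤ
open import Data.List using (List; []; _∷_; _++_; length; reverse; _ʳ++_)
open import Data.List.Properties using (++-identityʳ; reverse-involutive)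
open import Data.Maybe using (Maybe; just; nothing)
open import Data.Nat using (ℕ; zero; suc; _+_; _*_)
import Data.Nat.Properties as ℕ
open import Data.Nat.Tactic.RingSolver using (solve-∀)
open import Data.Product using (Σ; _×_; _,_)
open import Data.Unit using (tt)
open import Function.Bundles using (_⤖_; _↔_; mk↔ₛ′; Equivalence)
open import Function.Construct.Composition using (_↔-∘_)
open import Function.Properties.Inverse using (↔⇒⤖)
open import Relation.Nullary using (Irrelevant)
open import Relation.Binary.PropositionalEquality
  using (_≡_; refl; sym; trans; cong; cong₂; module ≡-Reasoning)

split-∧ : ∀ {x y} → T (x ∧ y) → T x × T y
split-∧ = Equivalence.to T-∧

join-∧ : ∀ {x y} → T x → T y → T (x ∧ y)
join-∧ p q = Equivalence.from T-∧ (p , q)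

×-irrelevant : {A B : Set} → Irrelevant A → Irrelevant B → Irrelevant (A × B)
×-irrelevant irrA irrB (a , b) (a′ , b′) = cong₂ _,_ (irrA a a′) (irrB b b′)

ℤ-≡-irrelevant : {i j : ℤ} → Irrelevant (i ≡ j)
ℤ-≡-irrelevant = Decidable⇒UIP.≡-irrelevant ℤ._≟_

module _ {A B : Set} {P : A → Set} {Q : B → Set}
         (P-irrelevant : ∀ {a} → Irrelevant (P a))
         (Q-irrelevant : ∀ {b} → Irrelevant (Q b)) where

  ↔-restrict : (f : A → B) (g : B → A) →
               (∀ {a} → P a → Q (f a)) → (∀ {b} → Q b → P (g b)) →
               (∀ {a} → P a → g (f a) ≡ a) → (∀ {b} → Q b → f (g b) ≡ b) →
               Σ A P ↔ Σ B Q
  ↔-restrict f g fP gQ gf fg = mk↔ₛ′ (λ (a , p) → f a , fP p) (λ (b , q) → g b , gQ q)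
    (λ (b , q) → Σ-≡ Q-irrelevant (fg q)) (λ (a , p) → Σ-≡ P-irrelevant (gf p))
    where
    Σ-≡ : {C : Set} {R : C → Set} → (∀ {c} → Irrelevant (R c)) →
          {c c′ : C} {r : R c} {r′ : R c′} → c ≡ c′ → _≡_ {A = Σ C R} (c , r) (c′ , r′)
    Σ-≡ irr {r = r} {r′} refl = cong (_ ,_) (irr r r′)

-- A blue leaf is `branch []`.
data CTree : Set where
  redLeaf : CTree
  branch  : List CTree → CTree

Forest : Set
Forest = List CTree

-- The forests to the left and to the right of the path at one vertex of it.
Level : Set
Level = Forest × Forest

-- Levels from the root down, and the forest below the distinguished vertex.
Spine : Set
Spine = List Level × Forest

-- Edges of a subtree, including the one joining it to its parent.
mutual
  size : CTree → ℕ
  size redLeaf    = 1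
  size (branch f) = suc (sizeF f)

  sizeF : Forest → ℕ
  sizeF []      = 0
  sizeF (t ∷ f) = size t + sizeF f

spineSize : Spine → ℕ
spineSize ([] , c)           = sizeF c
spineSize ((a , b) ∷ ls , c) = sizeF a + suc (spineSize (ls , c) + sizeF b)

leafColor : Forest → Maybe Color
leafColor []      = just blue
leafColor (_ ∷ _) = nothing

mutual
  toPlane : CTree → PlaneTree Label
  toPlane redLeaf    = node (false , just red) []
  toPlane (branch f) = node (false , leafColor f) (toPlaneF f)

  toPlaneF : Forest → List (PlaneTree Label)
  toPlaneF []      = []
  toPlaneF (t ∷ f) = toPlane t ∷ toPlaneF f

mutual
  fromPlane : PlaneTree Label → CTree
  fromPlane (node (_ , just red) []) = redLeaf
  fromPlane (node _ ts)              = branch (fromPlaneF ts)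

  fromPlaneF : List (PlaneTree Label) → Forest
  fromPlaneF []       = []
  fromPlaneF (t ∷ ts) = fromPlane t ∷ fromPlaneF ts

spineToPlane : Spine → PlaneTree Label
spineToPlane ([] , c)           = node (true , nothing) (toPlaneF c)
spineToPlane ((a , b) ∷ ls , c) =
  node (false , nothing) (toPlaneF a ++ spineToPlane (ls , c) ∷ toPlaneF b)

-- The first clause is never reached from a valid tree.
pushLeft : CTree → Spine → Spine
pushLeft x ([] , c)           = ([] , c)
pushLeft x ((a , b) ∷ ls , c) = ((x ∷ a , b) ∷ ls , c)

pushLevel : Forest → Spine → Spine
pushLevel b (ls , c) = (([] , b) ∷ ls , c)

mutual
  planeToSpine : PlaneTree Label → Spine
  planeToSpine (node (true , _) ts)  = ([] , fromPlaneF ts)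
  planeToSpine (node (false , _) ts) = descend ts

  descend : List (PlaneTree Label) → Spine
  descend []       = ([] , [])
  descend (t ∷ ts) with marks t
  ... | zero  = pushLeft (fromPlane t) (descend ts)
  ... | suc _ = pushLevel (fromPlaneF ts) (planeToSpine t)

edgesF-++ : (xs ys : List (PlaneTree Label)) → edgesF (xs ++ ys) ≡ edgesF xs + edgesF ys
edgesF-++ []       ys = refl
edgesF-++ (x ∷ xs) ys =
  cong suc (trans (cong (λ e → edges x + e) (edgesF-++ xs ys)) (sym (ℕ.+-assoc (edges x) _ _)))

marksF-++ : (xs ys : List (PlaneTree Label)) → marksF (xs ++ ys) ≡ marksF xs + marksF ys
marksF-++ []       ys = refl
marksF-++ (x ∷ xs) ys =
  trans (cong (λ k → marks x + k) (marksF-++ xs ys)) (sym (ℕ.+-assoc (marks x) _ _))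

colorOkF-++ : ∀ xs {ys} → T (colorOkF xs) → T (colorOkF ys) → T (colorOkF (xs ++ ys))
colorOkF-++ []       _ q = q
colorOkF-++ (x ∷ xs) p q = let px , pxs = split-∧ {colorOkSub x} p in join-∧ px (colorOkF-++ xs pxs q)

mutual
  fromPlane-toPlane : ∀ t → fromPlane (toPlane t) ≡ t
  fromPlane-toPlane redLeaf          = refl
  fromPlane-toPlane (branch [])      = refl
  fromPlane-toPlane (branch (t ∷ f)) = cong branch (fromPlaneF-toPlaneF (t ∷ f))

  fromPlaneF-toPlaneF : ∀ f → fromPlaneF (toPlaneF f) ≡ f
  fromPlaneF-toPlaneF []      = refl
  fromPlaneF-toPlaneF (t ∷ f) = cong₂ _∷_ (fromPlane-toPlane t) (fromPlaneF-toPlaneF f)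

mutual
  marks-toPlane : ∀ t → marks (toPlane t) ≡ 0
  marks-toPlane redLeaf    = refl
  marks-toPlane (branch f) = marksF-toPlaneF f

  marksF-toPlaneF : ∀ f → marksF (toPlaneF f) ≡ 0
  marksF-toPlaneF []      = refl
  marksF-toPlaneF (t ∷ f) = cong₂ _+_ (marks-toPlane t) (marksF-toPlaneF f)

mutual
  edges-toPlane : ∀ t → suc (edges (toPlane t)) ≡ size t
  edges-toPlane redLeaf    = refl
  edges-toPlane (branch f) = cong suc (edgesF-toPlaneF f)

  edgesF-toPlaneF : ∀ f → edgesF (toPlaneF f) ≡ sizeF f
  edgesF-toPlaneF []      = refl
  edgesF-toPlaneF (t ∷ f) = cong₂ _+_ (edges-toPlane t) (edgesF-toPlaneF f)

mutual
  colorOk-toPlane : ∀ t → T (colorOkSub (toPlane t))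
  colorOk-toPlane redLeaf          = tt
  colorOk-toPlane (branch [])      = tt
  colorOk-toPlane (branch (t ∷ f)) = colorOk-toPlaneF (t ∷ f)

  colorOk-toPlaneF : ∀ f → T (colorOkF (toPlaneF f))
  colorOk-toPlaneF []      = tt
  colorOk-toPlaneF (t ∷ f) = join-∧ (colorOk-toPlane t) (colorOk-toPlaneF f)

mutual
  toPlane-fromPlane : ∀ t → marks t ≡ 0 → T (colorOkSub t) → toPlane (fromPlane t) ≡ t
  toPlane-fromPlane (node (true , _) _)                ()
  toPlane-fromPlane (node (false , nothing) [])        _  ()
  toPlane-fromPlane (node (false , nothing) (u ∷ us))  m0 ok =
    cong (node _) (toPlaneF-fromPlaneF (u ∷ us) m0 ok)
  toPlane-fromPlane (node (false , just red) [])       _  _  = refl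
  toPlane-fromPlane (node (false , just red) (_ ∷ _))  _  ()
  toPlane-fromPlane (node (false , just blue) [])      _  _  = refl
  toPlane-fromPlane (node (false , just blue) (_ ∷ _)) _  ()

  toPlaneF-fromPlaneF : ∀ ts → marksF ts ≡ 0 → T (colorOkF ts) → toPlaneF (fromPlaneF ts) ≡ ts
  toPlaneF-fromPlaneF []       _  _  = refl
  toPlaneF-fromPlaneF (t ∷ ts) m0 ok =
    let okt , okts = split-∧ {colorOkSub t} ok in
    cong₂ _∷_ (toPlane-fromPlane t (ℕ.m+n≡0⇒m≡0 (marks t) m0) okt)
              (toPlaneF-fromPlaneF ts (ℕ.m+n≡0⇒n≡0 (marks t) m0) okts)

marks-spineToPlane : ∀ m → marks (spineToPlane m) ≡ 1
marks-spineToPlane ([] , c)           = cong suc (marksF-toPlaneF c)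
marks-spineToPlane ((a , b) ∷ ls , c) = begin
  marksF (toPlaneF a ++ spineToPlane (ls , c) ∷ toPlaneF b)
    ≡⟨ marksF-++ (toPlaneF a) _ ⟩
  marksF (toPlaneF a) + (marks (spineToPlane (ls , c)) + marksF (toPlaneF b))
    ≡⟨ cong₂ _+_ (marksF-toPlaneF a) (cong₂ _+_ (marks-spineToPlane (ls , c)) (marksF-toPlaneF b)) ⟩
  1 ∎
  where open ≡-Reasoning

edges-spineToPlane : ∀ m → edges (spineToPlane m) ≡ spineSize m
edges-spineToPlane ([] , c)           = edgesF-toPlaneF c
edges-spineToPlane ((a , b) ∷ ls , c) = begin
  edgesF (toPlaneF a ++ spineToPlane (ls , c) ∷ toPlaneF b)
    ≡⟨ edgesF-++ (toPlaneF a) _ ⟩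
  edgesF (toPlaneF a) + suc (edges (spineToPlane (ls , c)) + edgesF (toPlaneF b))
    ≡⟨ cong₂ (λ x y → x + suc y) (edgesF-toPlaneF a)
             (cong₂ _+_ (edges-spineToPlane (ls , c)) (edgesF-toPlaneF b)) ⟩
  spineSize ((a , b) ∷ ls , c) ∎
  where open ≡-Reasoning

mutual
  colorOkSub-spineToPlane : ∀ ls c → T (colorOkSub (spineToPlane (ls , c)))
  colorOkSub-spineToPlane []             []      = tt
  colorOkSub-spineToPlane []             (t ∷ c) = colorOk-toPlaneF (t ∷ c)
  colorOkSub-spineToPlane ((a , b) ∷ ls) c       with toPlaneF a | colorOk-children a b ls c
  ... | []    | ok = ok
  ... | _ ∷ _ | ok = ok

  colorOk-children : ∀ a b ls c → T (colorOkF (toPlaneF a ++ spineToPlane (ls , c) ∷ toPlaneF b))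
  colorOk-children a b ls c =
    colorOkF-++ (toPlaneF a) (colorOk-toPlaneF a) (join-∧ (colorOkSub-spineToPlane ls c) (colorOk-toPlaneF b))

colorOkRoot-spineToPlane : ∀ m → T (colorOkRoot (spineToPlane m))
colorOkRoot-spineToPlane ([] , c)           = colorOk-toPlaneF c
colorOkRoot-spineToPlane ((a , b) ∷ ls , c) = colorOk-children a b ls c

mutual
  planeToSpine-spineToPlane : ∀ ls c → planeToSpine (spineToPlane (ls , c)) ≡ (ls , c)
  planeToSpine-spineToPlane []             c = cong ([] ,_) (fromPlaneF-toPlaneF c)
  planeToSpine-spineToPlane ((a , b) ∷ ls) c = descend-spine a b ls c

  descend-spine : ∀ a b ls c → descend (toPlaneF a ++ spineToPlane (ls , c) ∷ toPlaneF b) ≡ ((a , b) ∷ ls , c)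
  descend-spine [] b ls c
    rewrite marks-spineToPlane (ls , c) | planeToSpine-spineToPlane ls c | fromPlaneF-toPlaneF b = refl
  descend-spine (t ∷ a) b ls c
    rewrite marks-toPlane t | descend-spine a b ls c | fromPlane-toPlane t = refl

-- The distinguished vertex is uncoloured, so both colouring conditions agree on it.
colorOkSub⇒colorOkRoot : ∀ t → marks t ≡ 1 → T (colorOkSub t) → T (colorOkRoot t)
colorOkSub⇒colorOkRoot (node (true , nothing) [])  _  _  = tt
colorOkSub⇒colorOkRoot (node (true , just _) [])   _  ()
colorOkSub⇒colorOkRoot (node (false , _) [])       ()
colorOkSub⇒colorOkRoot (node _ (_ ∷ _))            _  ok = ok

spineToPlane-pushLeft : ∀ x m {ts} → spineToPlane m ≡ node (false , nothing) ts →
                        spineToPlane (pushLeft x m) ≡ node (false , nothing) (toPlane x ∷ ts)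
spineToPlane-pushLeft x ((_ , _) ∷ _ , _) refl = refl

mutual
  spineToPlane-planeToSpine : ∀ t → marks t ≡ 1 → T (colorOkRoot t) → spineToPlane (planeToSpine t) ≡ t
  spineToPlane-planeToSpine (node (true , nothing) ts) m1 ok =
    cong (node _) (toPlaneF-fromPlaneF ts (ℕ.suc-injective m1) ok)
  spineToPlane-planeToSpine (node (true , just _) _)   _  ()
  spineToPlane-planeToSpine (node (false , nothing) ts) m1 ok = spineToPlane-descend ts m1 ok
  spineToPlane-planeToSpine (node (false , just _) _)  _  ()

  spineToPlane-descend : ∀ ts → marksF ts ≡ 1 → T (colorOkF ts) →
                         spineToPlane (descend ts) ≡ node (false , nothing) ts
  spineToPlane-descend (t ∷ ts) m1 ok with marks t in mt | split-∧ {colorOkSub t} ok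
  ... | zero | okt , okts =
    trans (spineToPlane-pushLeft (fromPlane t) (descend ts) (spineToPlane-descend ts m1 okts))
          (cong (λ u → node (false , nothing) (u ∷ ts)) (toPlane-fromPlane t mt okt))
  ... | suc zero | okt , okts =
    cong₂ (λ u us → node (false , nothing) (u ∷ us))
          (spineToPlane-planeToSpine t mt (colorOkSub⇒colorOkRoot t mt okt))
          (toPlaneF-fromPlaneF ts (ℕ.suc-injective m1) okts)

data Side : Set where
  above below : Side

rise fall : Side → Step
rise above = U
rise below = D
fall above = D
fall below = U

mutual
  encodeTree : Side → CTree → List Step → List Step
  encodeTree s redLeaf    k = H ∷ k
  encodeTree s (branch f) k = rise s ∷ encodeForest s f (fall s ∷ k)

  encodeForest : Side → Forest → List Step → List Step
  encodeForest s []      k = k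
  encodeForest s (t ∷ f) k = encodeTree s t (encodeForest s f k)

encodeLevel : Level → List Step → List Step
encodeLevel (a , b) k = encodeForest above a (D ∷ encodeForest below b (U ∷ k))

encode : Spine → List Step
encode ([] , c)     = encodeForest above c []
encode (l ∷ ls , c) = encodeLevel l (encode (ls , c))

-- Besides the levels already read (innermost first), a state holds the stack of
-- forests of the enclosing unfinished subtrees and the current forest, both
-- reversed; `lower` also holds the left forest of the level being read.
data State : Set where
  upper : List Level → List Forest → Forest → State
  lower : List Level → Forest → List Forest → Forest → State

step : Step → State → State
step H (upper ls stk cur)         = upper ls stk (redLeaf ∷ cur)
step U (upper ls stk cur)         = upper ls (cur ∷ stk) []
step D (upper ls (f ∷ stk) cur)   = upper ls stk (branch (reverse cur) ∷ f)
step D (upper ls [] cur)          = lower ls (reverse cur) [] []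
step H (lower ls a stk cur)       = lower ls a stk (redLeaf ∷ cur)
step D (lower ls a stk cur)       = lower ls a (cur ∷ stk) []
step U (lower ls a (f ∷ stk) cur) = lower ls a stk (branch (reverse cur) ∷ f)
step U (lower ls a [] cur)        = upper ((a , reverse cur) ∷ ls) [] []

run : List Step → State → State
run []      st = st
run (x ∷ s) st = run s (step x st)

initial : State
initial = upper [] [] []

finish : State → Spine
finish (upper ls [] cur) = (reverse ls , reverse cur)
finish _                 = ([] , [])

decode : List Step → Spine
decode s = finish (run s initial)

mutual
  run-encodeTree-above : ∀ t k ls stk cur →
    run (encodeTree above t k) (upper ls stk cur) ≡ run k (upper ls stk (t ∷ cur))
  run-encodeTree-above redLeaf    k ls stk cur = refl
  run-encodeTree-above (branch f) k ls stk cur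
    rewrite run-encodeForest-above f (D ∷ k) ls (cur ∷ stk) [] | reverse-involutive f = refl

  run-encodeForest-above : ∀ f k ls stk cur →
    run (encodeForest above f k) (upper ls stk cur) ≡ run k (upper ls stk (f ʳ++ cur))
  run-encodeForest-above []      k ls stk cur = refl
  run-encodeForest-above (t ∷ f) k ls stk cur =
    trans (run-encodeTree-above t _ ls stk cur) (run-encodeForest-above f k ls stk (t ∷ cur))

mutual
  run-encodeTree-below : ∀ t k ls a stk cur →
    run (encodeTree below t k) (lower ls a stk cur) ≡ run k (lower ls a stk (t ∷ cur))
  run-encodeTree-below redLeaf    k ls a stk cur = refl
  run-encodeTree-below (branch f) k ls a stk cur
    rewrite run-encodeForest-below f (U ∷ k) ls a (cur ∷ stk) [] | reverse-involutive f = refl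

  run-encodeForest-below : ∀ f k ls a stk cur →
    run (encodeForest below f k) (lower ls a stk cur) ≡ run k (lower ls a stk (f ʳ++ cur))
  run-encodeForest-below []      k ls a stk cur = refl
  run-encodeForest-below (t ∷ f) k ls a stk cur =
    trans (run-encodeTree-below t _ ls a stk cur) (run-encodeForest-below f k ls a stk (t ∷ cur))

run-encode : ∀ ls c acc → run (encode (ls , c)) (upper acc [] []) ≡ upper (ls ʳ++ acc) [] (reverse c)
run-encode []             c acc = run-encodeForest-above c [] acc [] []
run-encode ((a , b) ∷ ls) c acc
  rewrite run-encodeForest-above a (D ∷ encodeForest below b (U ∷ encode (ls , c))) acc [] []
        | reverse-involutive a
        | run-encodeForest-below b (U ∷ encode (ls , c)) acc a [] []
        | reverse-involutive b
  = run-encode ls c ((a , b) ∷ acc)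

decode-encode : ∀ m → decode (encode m) ≡ m
decode-encode (ls , c) rewrite run-encode ls c [] | reverse-involutive ls | reverse-involutive c = refl

-- `replay st k`: the steps leading from `initial` to `st`, followed by `k`.
replayForest : Side → Forest → List Step → List Step
replayForest s []        k = k
replayForest s (t ∷ cur) k = replayForest s cur (encodeTree s t k)

replayStack : Side → List Forest → List Step → List Step
replayStack s []        k = k
replayStack s (f ∷ stk) k = replayStack s stk (replayForest s f (rise s ∷ k))

replayLevels : List Level → List Step → List Step
replayLevels []       k = k
replayLevels (l ∷ ls) k = replayLevels ls (encodeLevel l k)

replay : State → List Step → List Step
replay (upper ls stk cur)   k = replayLevels ls (replayStack above stk (replayForest above cur k))
replay (lower ls a stk cur) k =
  replayLevels ls (encodeForest above a (D ∷ replayStack below stk (replayForest below cur k)))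

encodeForest-ʳ++ : ∀ s cur acc k → encodeForest s (cur ʳ++ acc) k ≡ replayForest s cur (encodeForest s acc k)
encodeForest-ʳ++ s []        acc k = refl
encodeForest-ʳ++ s (t ∷ cur) acc k = encodeForest-ʳ++ s cur (t ∷ acc) k

encode-ʳ++ : ∀ ls acc c → encode (ls ʳ++ acc , c) ≡ replayLevels ls (encode (acc , c))
encode-ʳ++ []       acc c = refl
encode-ʳ++ (l ∷ ls) acc c = encode-ʳ++ ls (l ∷ acc) c

replay-step : ∀ x st k → replay (step x st) k ≡ replay st (x ∷ k)
replay-step H (upper ls stk cur)         k = refl
replay-step U (upper ls stk cur)         k = refl
replay-step D (upper ls (_ ∷ _) cur)     k rewrite encodeForest-ʳ++ above cur [] (D ∷ k) = refl
replay-step D (upper ls [] cur)          k rewrite encodeForest-ʳ++ above cur [] (D ∷ k) = refl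
replay-step H (lower ls a stk cur)       k = refl
replay-step D (lower ls a stk cur)       k = refl
replay-step U (lower ls a (_ ∷ _) cur)   k rewrite encodeForest-ʳ++ below cur [] (U ∷ k) = refl
replay-step U (lower ls a [] cur)        k rewrite encodeForest-ʳ++ below cur [] (U ∷ k) = refl

replay-run : ∀ s st k → replay (run s st) k ≡ replay st (s ++ k)
replay-run []      st k = refl
replay-run (x ∷ s) st k = trans (replay-run s (step x st) k) (replay-step x st (s ++ k))

stepHeight : Step → ℤ
stepHeight U = + 1
stepHeight H = + 0
stepHeight D = -[1+ 0 ]

height-∷ : ∀ x s → height (x ∷ s) ≡ stepHeight x +ℤ height s
height-∷ U s = refl
height-∷ H s = sym (ℤ.+-identityˡ (height s))
height-∷ D s = refl

altitude : State → ℤ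
altitude (upper _ stk _)   = + length stk
altitude (lower _ _ stk _) = -[1+ length stk ]

altitude-step : ∀ x st → altitude (step x st) ≡ stepHeight x +ℤ altitude st
altitude-step H (upper _ _ _)         = refl
altitude-step U (upper _ _ _)         = refl
altitude-step D (upper _ (_ ∷ _) _)   = refl
altitude-step D (upper _ [] _)        = refl
altitude-step H (lower _ _ _ _)       = refl
altitude-step D (lower _ _ _ _)       = refl
altitude-step U (lower _ _ (_ ∷ _) _) = refl
altitude-step U (lower _ _ [] _)      = refl

altitude-run : ∀ s st → altitude (run s st) ≡ height s +ℤ altitude st
altitude-run []      st = sym (ℤ.+-identityˡ (altitude st))
altitude-run (x ∷ s) st = begin
  altitude (run s (step x st))             ≡⟨ altitude-run s (step x st) ⟩
  height s +ℤ altitude (step x st)         ≡⟨ cong (height s +ℤ_) (altitude-step x st) ⟩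
  height s +ℤ (stepHeight x +ℤ altitude st) ≡⟨ ℤ.+-assoc (height s) _ _ ⟨
  (height s +ℤ stepHeight x) +ℤ altitude st ≡⟨ cong (_+ℤ altitude st) (ℤ.+-comm (height s) _) ⟩
  (stepHeight x +ℤ height s) +ℤ altitude st ≡⟨ cong (_+ℤ altitude st) (height-∷ x s) ⟨
  height (x ∷ s) +ℤ altitude st            ∎
  where open ≡-Reasoning

encode-finish : ∀ st → altitude st ≡ + 0 → encode (finish st) ≡ replay st []
encode-finish (upper ls [] cur) _
  rewrite encode-ʳ++ ls [] (reverse cur) | encodeForest-ʳ++ above cur [] [] = refl
encode-finish (upper _ (_ ∷ _) _) ()
encode-finish (lower _ _ _ _)     ()

encode-decode : ∀ s → height s ≡ + 0 → encode (decode s) ≡ s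
encode-decode s h = begin
  encode (finish (run s initial)) ≡⟨ encode-finish _ (trans (altitude-run s initial) (cong (_+ℤ + 0) h)) ⟩
  replay (run s initial) []       ≡⟨ replay-run s initial [] ⟩
  s ++ []                         ≡⟨ ++-identityʳ s ⟩
  s                               ∎
  where open ≡-Reasoning

-- The parser ends an encoding on the axis, so encodings are closed paths.
height-encode : ∀ m → height (encode m) ≡ + 0
height-encode m@(ls , c) = begin
  height (encode m)                       ≡⟨ ℤ.+-identityʳ _ ⟨
  height (encode m) +ℤ altitude initial   ≡⟨ altitude-run (encode m) initial ⟨
  altitude (run (encode m) initial)       ≡⟨ cong altitude (run-encode ls c []) ⟩
  + 0                                     ∎
  where open ≡-Reasoning

xlen-rise : ∀ s k → xlen (rise s ∷ k) ≡ suc (xlen k)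
xlen-rise above k = refl
xlen-rise below k = refl

xlen-fall : ∀ s k → xlen (fall s ∷ k) ≡ suc (xlen k)
xlen-fall above k = refl
xlen-fall below k = refl

mutual
  xlen-encodeTree : ∀ s t k → xlen (encodeTree s t k) ≡ 2 * size t + xlen k
  xlen-encodeTree s redLeaf    k = refl
  xlen-encodeTree s (branch f) k
    rewrite xlen-rise s (encodeForest s f (fall s ∷ k))
          | xlen-encodeForest s f (fall s ∷ k)
          | xlen-fall s k
    = arith (sizeF f) (xlen k)
    where arith : ∀ x y → suc (2 * x + suc y) ≡ 2 * suc x + y
          arith = solve-∀

  xlen-encodeForest : ∀ s f k → xlen (encodeForest s f k) ≡ 2 * sizeF f + xlen k
  xlen-encodeForest s []      k = refl
  xlen-encodeForest s (t ∷ f) k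
    rewrite xlen-encodeTree s t (encodeForest s f k) | xlen-encodeForest s f k
    = arith (size t) (sizeF f) (xlen k)
    where arith : ∀ x y z → 2 * x + (2 * y + z) ≡ 2 * (x + y) + z
          arith = solve-∀

xlen-encode : ∀ m → xlen (encode m) ≡ 2 * spineSize m
xlen-encode ([] , c) = trans (xlen-encodeForest above c []) (ℕ.+-identityʳ _)
xlen-encode ((a , b) ∷ ls , c) = begin
  xlen (encodeLevel (a , b) (encode (ls , c)))
    ≡⟨ xlen-encodeForest above a _ ⟩
  2 * sizeF a + suc (xlen (encodeForest below b (U ∷ encode (ls , c))))
    ≡⟨ cong (λ x → 2 * sizeF a + suc x) (xlen-encodeForest below b _) ⟩
  2 * sizeF a + suc (2 * sizeF b + suc (xlen (encode (ls , c))))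
    ≡⟨ cong (λ x → 2 * sizeF a + suc (2 * sizeF b + suc x)) (xlen-encode (ls , c)) ⟩
  2 * sizeF a + suc (2 * sizeF b + suc (2 * spineSize (ls , c)))
    ≡⟨ arith (sizeF a) (sizeF b) (spineSize (ls , c)) ⟩
  2 * spineSize ((a , b) ∷ ls , c) ∎
  where open ≡-Reasoning
        arith : ∀ x y z → 2 * x + suc (2 * y + suc (2 * z)) ≡ 2 * (x + suc (z + y))
        arith = solve-∀

SpineOfSize : ℕ → Set
SpineOfSize n = Σ Spine λ m → spineSize m ≡ n

trees↔spines : ∀ n → LCDRTree n ↔ SpineOfSize n
trees↔spines n = ↔-restrict
  (×-irrelevant ℕ.≡-irrelevant (×-irrelevant ℕ.≡-irrelevant T-irrelevant)) ℕ.≡-irrelevant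
  planeToSpine spineToPlane
  (λ {t} (e , mk , ok) → trans (sym (edges-spineToPlane (planeToSpine t)))
                               (trans (cong edges (spineToPlane-planeToSpine t mk ok)) e))
  (λ {m} sz → trans (edges-spineToPlane m) sz , marks-spineToPlane m , colorOkRoot-spineToPlane m)
  (λ {t} (_ , mk , ok) → spineToPlane-planeToSpine t mk ok)
  (λ {(ls , c)} _ → planeToSpine-spineToPlane ls c)

spines↔paths : ∀ n → SpineOfSize n ↔ FreeSchroeder n
spines↔paths n = ↔-restrict
  ℕ.≡-irrelevant (×-irrelevant ℕ.≡-irrelevant ℤ-≡-irrelevant)
  encode decode
  (λ {m} sz → trans (xlen-encode m) (cong (2 *_) sz) , height-encode m)
  (λ {s} (xl , h) → ℕ.*-cancelˡ-≡ _ n 2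
    (trans (sym (xlen-encode (decode s))) (trans (cong xlen (encode-decode s h)) xl)))
  (λ {m} _ → decode-encode m)
  (λ {s} (_ , h) → encode-decode s h)

theorem3p6 : (n : ℕ) → LCDRTree n ⤖ FreeSchroeder n
theorem3p6 n = ↔⇒⤖ (spines↔paths n ↔-∘ trees↔spines n)
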